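{- Let $G$ be a strongly connected digraph with diameter at most $2$ that contains the pattern $\mathcal{F}_4$ or the pattern $\mathcal{F}_5$. Here $G$ contains $\mathcal{F}_4$ if there are three distinct vertices $u,v,w$ with $(u,v),(v,u),(v,w)$ arcs of $G$ and $(w,v),(u,w),(w,u)$ not arcs of $G$; and $G$ contains $\mathcal{F}_5$ if there are three distinct vertices $u,v,w$ with $(u,v),(v,u),(w,v)$ arcs of $G$ and $(v,w),(u,w),(w,u)$ not arcs of $G$. Then $I_2(G)=\langle 1\rangle$.
   Context: A digraph is simple: no loops and no multiple arcs. It is strongly connected if for all vertices $u,v$ there is a directed $uv$-walk. $\operatorname{dist}(u,v)$ is the number of arcs of a shortest directed $uv$-walk; the diameter is the maximum distance. $D_X(G)=\operatorname{diag}(x_u)_{u\in V(G)}+D(G)$, where $D(G)$ is the distance matrix and $x_u$ are indeterminates; $I_2(G)$ is the ideal of $\mathbb{Z}[x_u:u\in V(G)]$ generated by all $2\times 2$ minors of $D_X(G)$. -}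

module Defs where

open import Data.Nat using (ℕ; zero; suc; _≤_)
open import Data.Fin using (Fin; _<_)
open import Data.Fin.Properties using (_≟_)
open import Data.Bool using (Bool; true; false)
open import Data.Product using (Σ; ∃; _×_; _,_)
open import Relation.Nullary using (¬_; yes; no)
open import Relation.Binary.PropositionalEquality using (_≡_; _≢_)

-- Digraphs on the vertex set Fin n.  An arc relation given as a Boolean
-- adjacency function automatically excludes multiple arcs; "simple"
-- additionally forbids loops.

record Digraph (n : ℕ) : Set where
  field
    arc    : Fin n → Fin n → Bool
    noLoop : ∀ u → arc u u ≡ false

open Digraph public

Arc : ∀ {n} → Digraph n → Fin n → Fin n → Set
Arc G u v = arc G u v ≡ true

NoArc : ∀ {n} → Digraph n → Fin n → Fin n → Set
NoArc G u v = arc G u v ≡ false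

data Walk {n} (G : Digraph n) : Fin n → Fin n → ℕ → Set where
  here : ∀ {u} → Walk G u u zero
  step : ∀ {u w v k} → Arc G u w → Walk G w v k → Walk G u v (suc k)

StronglyConnected : ∀ {n} → Digraph n → Set
StronglyConnected G = ∀ u v → ∃ λ k → Walk G u v k

IsDistance : ∀ {n} → Digraph n → (Fin n → Fin n → ℕ) → Set
IsDistance G d =
  ∀ u v → Walk G u v (d u v) × (∀ k → Walk G u v k → d u v ≤ k)

DiameterAtMost2 : ∀ {n} → Digraph n → (Fin n → Fin n → ℕ) → Set
DiameterAtMost2 {n} G d = ∀ (u v : Fin n) → d u v ≤ 2

ContainsF4 : ∀ {n} → Digraph n → Set
ContainsF4 {n} G = Σ (Fin n) λ u → Σ (Fin n) λ v → Σ (Fin n) λ w →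
  (u ≢ v) × (v ≢ w) × (u ≢ w) ×
  Arc G u v × Arc G v u × Arc G v w ×
  NoArc G w v × NoArc G u w × NoArc G w u

ContainsF5 : ∀ {n} → Digraph n → Set
ContainsF5 {n} G = Σ (Fin n) λ u → Σ (Fin n) λ v → Σ (Fin n) λ w →
  (u ≢ v) × (v ≢ w) × (u ≢ w) ×
  Arc G u v × Arc G v u × Arc G w v ×
  NoArc G v w × NoArc G u w × NoArc G w u

-- The polynomial ring ℤ[x_u : u ∈ Fin n], constructed as the free
-- commutative ring on the generators x_u: ring terms modulo the
-- congruence generated by the commutative-ring axioms.

data Poly (n : ℕ) : Set where
  var  : Fin n → Poly n
  `0   : Poly n
  `1   : Poly n
  _⊕_  : Poly n → Poly n → Poly n
  _⊗_  : Poly n → Poly n → Poly n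
  ⊖_   : Poly n → Poly n

infixl 6 _⊕_
infixl 7 _⊗_
infix  8 ⊖_
infix  4 _≈_

data _≈_ {n} : Poly n → Poly n → Set where
  ≈-refl   : ∀ {p} → p ≈ p
  ≈-sym    : ∀ {p q} → p ≈ q → q ≈ p
  ≈-trans  : ∀ {p q r} → p ≈ q → q ≈ r → p ≈ r
  ⊕-cong   : ∀ {p p′ q q′} → p ≈ p′ → q ≈ q′ → p ⊕ q ≈ p′ ⊕ q′
  ⊗-cong   : ∀ {p p′ q q′} → p ≈ p′ → q ≈ q′ → p ⊗ q ≈ p′ ⊗ q′
  ⊖-cong   : ∀ {p q} → p ≈ q → ⊖ p ≈ ⊖ q
  ⊕-assoc  : ∀ p q r → (p ⊕ q) ⊕ r ≈ p ⊕ (q ⊕ r)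
  ⊕-comm   : ∀ p q → p ⊕ q ≈ q ⊕ p
  ⊕-identʳ : ∀ p → p ⊕ `0 ≈ p
  ⊖-invʳ   : ∀ p → p ⊕ ⊖ p ≈ `0
  ⊗-assoc  : ∀ p q r → (p ⊗ q) ⊗ r ≈ p ⊗ (q ⊗ r)
  ⊗-comm   : ∀ p q → p ⊗ q ≈ q ⊗ p
  ⊗-identʳ : ∀ p → p ⊗ `1 ≈ p
  distribʳ : ∀ p q r → (p ⊕ q) ⊗ r ≈ p ⊗ r ⊕ q ⊗ r

fromℕ : ∀ {n} → ℕ → Poly n
fromℕ zero    = `0
fromℕ (suc k) = `1 ⊕ fromℕ k

data InIdeal {n} (S : Poly n → Set) : Poly n → Set where
  gen  : ∀ {p} → S p → InIdeal S p
  zer  : InIdeal S `0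
  add  : ∀ {p q} → InIdeal S p → InIdeal S q → InIdeal S (p ⊕ q)
  mul  : ∀ {p} (r : Poly n) → InIdeal S p → InIdeal S (r ⊗ p)
  resp : ∀ {p q} → p ≈ q → InIdeal S p → InIdeal S q

DX : ∀ {n} → (Fin n → Fin n → ℕ) → Fin n → Fin n → Poly n
DX d i j with i ≟ j
... | yes _ = var i ⊕ fromℕ (d i j)
... | no  _ = fromℕ (d i j)

Minor2 : ∀ {n} → (Fin n → Fin n → Poly n) → Poly n → Set
Minor2 {n} M p = Σ (Fin n) λ i₁ → Σ (Fin n) λ i₂ → Σ (Fin n) λ j₁ → Σ (Fin n) λ j₂ →
  (i₁ < i₂) × (j₁ < j₂) ×
  (p ≡ M i₁ j₁ ⊗ M i₂ j₂ ⊕ ⊖ (M i₁ j₂ ⊗ M i₂ j₁))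

I₂ : ∀ {n} → (Fin n → Fin n → ℕ) → Poly n → Set
I₂ d = InIdeal (Minor2 (DX d))

-- Both patterns give d(u,v) = d(v,u) = 1 and d(u,w) = d(w,u) = 2. The 2×2 minors of D_X on rows
-- {u,v}, columns {v,w} and on rows {v,w}, columns {u,v} are then d(v,w) − 2x_v and d(w,v) − 2x_v,
-- so I₂(G) contains their difference d(v,w) − d(w,v), which is 1 − 2 for F4 and 2 − 1 for F5.
module Submission where

open import Level using (0ℓ)
open import Algebra.Bundles using (CommutativeRing)

module RingIdentities {c ℓ} (R : CommutativeRing c ℓ) where
  open CommutativeRing R
  open import Algebra.Properties.AbelianGroup +-abelianGroup using (⁻¹-anti-homo‿-)
  open import Algebra.Properties.CommutativeSemigroup +-commutativeSemigroup
    using (interchange)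
  open import Relation.Binary.Reasoning.Setoid setoid

  [ab-cy]-[a′e-yc′]≈b-e : ∀ {a a′ c c′} b e y → a ≈ 1# → a′ ≈ 1# → c′ ≈ c →
    (a * b - c * y) - (a′ * e - y * c′) ≈ b - e
  [ab-cy]-[a′e-yc′]≈b-e {a} {a′} {c} {c′} b e y a≈1 a′≈1 c′≈c = begin
    (a * b - c * y) - (a′ * e - y * c′)     ≈⟨ +-congˡ (⁻¹-anti-homo‿- (a′ * e) (y * c′)) ⟩
    (a * b - c * y) + (y * c′ - a′ * e)     ≈⟨ +-congˡ (+-comm (y * c′) (- (a′ * e))) ⟩
    (a * b - c * y) + (- (a′ * e) + y * c′) ≈⟨ interchange _ _ _ _ ⟩
    (a * b - a′ * e) + (- (c * y) + y * c′) ≈⟨ +-cong (+-cong (≈1⇒*-identityˡ a≈1 b)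
                                                       (-‿cong (≈1⇒*-identityˡ a′≈1 e)))
                                                       -cy+yc′≈0 ⟩
    (b - e) + 0#                            ≈⟨ +-identityʳ (b - e) ⟩
    b - e                                   ∎
    where
    ≈1⇒*-identityˡ : ∀ {u} → u ≈ 1# → ∀ x → u * x ≈ x
    ≈1⇒*-identityˡ u≈1 x = trans (*-congʳ u≈1) (*-identityˡ x)

    -cy+yc′≈0 : - (c * y) + y * c′ ≈ 0#
    -cy+yc′≈0 = trans (+-congˡ (trans (*-comm y c′) (*-congʳ c′≈c))) (-‿inverseˡ (c * y))

-- Imported only here: Defs._≈_ would clash with the ring's _≈_ above.
open import Defs
open import Data.Nat using (ℕ; suc; s≤s)
open import Data.Fin using (Fin; _<_)
open import Data.Fin.Properties using (_≟_; <-cmp)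
open import Data.Sum using (_⊎_; inj₁; inj₂)
open import Data.Product using (_,_; proj₁; proj₂)
open import Relation.Nullary using (yes; no; contradiction)
open import Relation.Binary.Definitions using (tri<; tri≈; tri>)
open import Relation.Binary.Bundles using (Setoid)
open import Relation.Binary.Structures using (IsEquivalence)
open import Relation.Binary.PropositionalEquality
  using (_≡_; _≢_; refl; sym; trans; cong; ≢-sym)
open import Algebra.Structures using (IsCommutativeRing)
import Algebra.Consequences.Setoid as Consequences

module _ {n : ℕ} where

  ≈-isEquivalence : IsEquivalence (_≈_ {n})
  ≈-isEquivalence = record { refl = ≈-refl ; sym = ≈-sym ; trans = ≈-trans }

  ≈-setoid : Setoid 0ℓ 0ℓ
  ≈-setoid = record { isEquivalence = ≈-isEquivalence }

  open Consequences ≈-setoid using (comm∧idʳ⇒id; comm∧invʳ⇒inv; comm∧distrʳ⇒distr)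

  Poly-isCommutativeRing : IsCommutativeRing (_≈_ {n}) _⊕_ _⊗_ ⊖_ `0 `1
  Poly-isCommutativeRing = record
    { isRing = record
      { +-isAbelianGroup = record
        { isGroup = record
          { isMonoid = record
            { isSemigroup = record
              { isMagma = record { isEquivalence = ≈-isEquivalence ; ∙-cong = ⊕-cong }
              ; assoc = ⊕-assoc }
            ; identity = comm∧idʳ⇒id ⊕-comm ⊕-identʳ }
          ; inverse = comm∧invʳ⇒inv ⊕-comm ⊖-invʳ
          ; ⁻¹-cong = ⊖-cong }
        ; comm = ⊕-comm }
      ; *-cong = ⊗-cong
      ; *-assoc = ⊗-assoc
      ; *-identity = comm∧idʳ⇒id ⊗-comm ⊗-identʳ
      ; distrib = comm∧distrʳ⇒distr ⊕-cong ⊗-comm (λ r p q → distribʳ p q r) }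
    ; *-comm = ⊗-comm }

Poly-commutativeRing : ℕ → CommutativeRing 0ℓ 0ℓ
Poly-commutativeRing n = record { isCommutativeRing = Poly-isCommutativeRing {n} }

module _ {n : ℕ} where
  open CommutativeRing (Poly-commutativeRing n) using (ring; +-abelianGroup; +-group)
  open import Algebra.Properties.Ring ring using (-1*x≈-x)
  open import Algebra.Properties.AbelianGroup +-abelianGroup using (⁻¹-anti-homo‿-)
  open import Algebra.Properties.Group +-group using (//-rightDividesʳ)

  module _ {S : Poly n → Set} where

    InIdeal-⊖ : ∀ {p} → InIdeal S p → InIdeal S (⊖ p)
    InIdeal-⊖ {p} p∈I = resp (-1*x≈-x p) (mul (⊖ `1) p∈I)

    InIdeal-− : ∀ {p q} → InIdeal S p → InIdeal S q → InIdeal S (p ⊕ ⊖ q)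
    InIdeal-− p∈I q∈I = add p∈I (InIdeal-⊖ q∈I)

    InIdeal-flip : ∀ {p q} → InIdeal S (p ⊕ ⊖ q) → InIdeal S (q ⊕ ⊖ p)
    InIdeal-flip {p} {q} p-q∈I = resp (⁻¹-anti-homo‿- p q) (InIdeal-⊖ p-q∈I)

    InIdeal-whole : InIdeal S `1 → ∀ p → InIdeal S p
    InIdeal-whole 1∈I p = resp (⊗-identʳ p) (mul p 1∈I)

    InIdeal-whole-from-2−1 : ∀ {p q} → InIdeal S (p ⊕ ⊖ q) →
      p ≡ fromℕ 2 → q ≡ fromℕ 1 → ∀ r → InIdeal S r
    InIdeal-whole-from-2−1 2-1∈I refl refl =
      InIdeal-whole (resp (//-rightDividesʳ (fromℕ 1) `1) 2-1∈I)

  minor₂ : (Fin n → Fin n → Poly n) → Fin n → Fin n → Fin n → Fin n → Poly n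
  minor₂ M i₁ i₂ j₁ j₂ = M i₁ j₁ ⊗ M i₂ j₂ ⊕ ⊖ (M i₁ j₂ ⊗ M i₂ j₁)

  module _ (M : Fin n → Fin n → Poly n) where

    minor₂-inIdeal-rowsOrdered : ∀ {i₁ i₂ j₁ j₂} → i₁ < i₂ → j₁ ≢ j₂ →
      InIdeal (Minor2 M) (minor₂ M i₁ i₂ j₁ j₂)
    minor₂-inIdeal-rowsOrdered {i₁} {i₂} {j₁} {j₂} i₁<i₂ j₁≢j₂ with <-cmp j₁ j₂
    ... | tri< j₁<j₂ _ _ = gen (i₁ , i₂ , j₁ , j₂ , i₁<i₂ , j₁<j₂ , refl)
    ... | tri≈ _ j₁≡j₂ _ = contradiction j₁≡j₂ j₁≢j₂
    ... | tri> _ _ j₂<j₁ = InIdeal-flip (gen (i₁ , i₂ , j₂ , j₁ , i₁<i₂ , j₂<j₁ , refl))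

    minor₂-inIdeal : ∀ {i₁ i₂ j₁ j₂} → i₁ ≢ i₂ → j₁ ≢ j₂ →
      InIdeal (Minor2 M) (minor₂ M i₁ i₂ j₁ j₂)
    minor₂-inIdeal {i₁} {i₂} i₁≢i₂ j₁≢j₂ with <-cmp i₁ i₂
    ... | tri< i₁<i₂ _ _ = minor₂-inIdeal-rowsOrdered i₁<i₂ j₁≢j₂
    ... | tri≈ _ i₁≡i₂ _ = contradiction i₁≡i₂ i₁≢i₂
    ... | tri> _ _ i₂<i₁ = resp (⊕-cong (⊗-comm _ _) (⊖-cong (⊗-comm _ _)))
                                (minor₂-inIdeal-rowsOrdered i₂<i₁ (≢-sym j₁≢j₂))

    minor₂-difference-inIdeal : ∀ {u v w} → u ≢ v → v ≢ w →
      M u v ≡ fromℕ 1 → M v u ≡ fromℕ 1 → M w u ≡ M u w →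
      InIdeal (Minor2 M) (M v w ⊕ ⊖ M w v)
    minor₂-difference-inIdeal {u} {v} {w} u≢v v≢w Muv≡1 Mvu≡1 Mwu≡Muw =
      resp ([ab-cy]-[a′e-yc′]≈b-e (M v w) (M w v) (M v v)
              (≡fromℕ1⇒≈1 Muv≡1) (≡fromℕ1⇒≈1 Mvu≡1) (reflexive Mwu≡Muw))
           (InIdeal-− (minor₂-inIdeal u≢v v≢w) (minor₂-inIdeal v≢w u≢v))
      where
      open RingIdentities (Poly-commutativeRing n)
      open IsEquivalence ≈-isEquivalence using (reflexive)

      ≡fromℕ1⇒≈1 : ∀ {p} → p ≡ fromℕ 1 → p ≈ `1
      ≡fromℕ1⇒≈1 refl = ⊕-identʳ `1

module Distances {n} {G : Digraph n} {d : Fin n → Fin n → ℕ} (isDist : IsDistance G d) where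

  walk₀⇒≡ : ∀ {u v} → Walk G u v 0 → u ≡ v
  walk₀⇒≡ here = refl

  walk₁⇒Arc : ∀ {u v} → Walk G u v 1 → Arc G u v
  walk₁⇒Arc (step uv here) = uv

  dist-arc : ∀ {u v} → u ≢ v → Arc G u v → d u v ≡ 1
  dist-arc {u} {v} u≢v uv with d u v | proj₁ (isDist u v) | proj₂ (isDist u v) 1 (step uv here)
  ... | 0 | walk | _ = contradiction (walk₀⇒≡ walk) u≢v
  ... | 1 | _    | _ = refl
  ... | suc (suc _) | _ | s≤s ()

  dist-noArc : DiameterAtMost2 G d → ∀ {u v} → u ≢ v → NoArc G u v → d u v ≡ 2
  dist-noArc diam {u} {v} u≢v ¬uv with d u v | proj₁ (isDist u v) | diam u v
  ... | 0 | walk | _ = contradiction (walk₀⇒≡ walk) u≢v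
  ... | 1 | walk | _ with () ← trans (sym (walk₁⇒Arc walk)) ¬uv
  ... | 2 | _    | _ = refl
  ... | suc (suc (suc _)) | _ | s≤s (s≤s ())

  DX-offDiag : ∀ {u v} → u ≢ v → DX d u v ≡ fromℕ (d u v)
  DX-offDiag {u} {v} u≢v with u ≟ v
  ... | yes u≡v = contradiction u≡v u≢v
  ... | no _    = refl

  module Diameter2 (diam : DiameterAtMost2 G d) where

    DX-arc : ∀ {u v} → u ≢ v → Arc G u v → DX d u v ≡ fromℕ 1
    DX-arc u≢v uv = trans (DX-offDiag u≢v) (cong fromℕ (dist-arc u≢v uv))

    DX-noArc : ∀ {u v} → u ≢ v → NoArc G u v → DX d u v ≡ fromℕ 2
    DX-noArc u≢v ¬uv = trans (DX-offDiag u≢v) (cong fromℕ (dist-noArc diam u≢v ¬uv))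

    asymmetry-inI₂ : ∀ {u v w} → u ≢ v → v ≢ w → u ≢ w →
      Arc G u v → Arc G v u → NoArc G u w → NoArc G w u →
      I₂ d (DX d v w ⊕ ⊖ DX d w v)
    asymmetry-inI₂ u≢v v≢w u≢w uv vu ¬uw ¬wu =
      minor₂-difference-inIdeal (DX d) u≢v v≢w
        (DX-arc u≢v uv) (DX-arc (≢-sym u≢v) vu)
        (trans (DX-noArc (≢-sym u≢w) ¬wu) (sym (DX-noArc u≢w ¬uw)))

lemma12 : (n : ℕ) (G : Digraph n) (d : Fin n → Fin n → ℕ) →
    StronglyConnected G → IsDistance G d → DiameterAtMost2 G d →
    ContainsF4 G ⊎ ContainsF5 G →
    ∀ (p : Poly n) → I₂ d p
lemma12 n G d _ isDist diam (inj₁ (u , v , w , u≢v , v≢w , u≢w , uv , vu , vw , ¬wv , ¬uw , ¬wu)) =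
  InIdeal-whole-from-2−1 (InIdeal-flip (asymmetry-inI₂ u≢v v≢w u≢w uv vu ¬uw ¬wu))
    (DX-noArc (≢-sym v≢w) ¬wv) (DX-arc v≢w vw)
  where open Distances isDist
        open Diameter2 diam
lemma12 n G d _ isDist diam (inj₂ (u , v , w , u≢v , v≢w , u≢w , uv , vu , wv , ¬vw , ¬uw , ¬wu)) =
  InIdeal-whole-from-2−1 (asymmetry-inI₂ u≢v v≢w u≢w uv vu ¬uw ¬wu)
    (DX-noArc v≢w ¬vw) (DX-arc (≢-sym v≢w) wv)
  where open Distances isDist
        open Diameter2 diam
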